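{- Let $m,n \in \mathbb{N}$ with $n \geq m$. Then, as $k \to \infty$ ($k\in\mathbb{N}$), $$\omega\binom{nk}{mk} = \sum_{j=1}^{\infty}\left(\pi\left(\frac{nk}{j}\right) - \pi\left(\frac{(n-m)k}{j}\right) - \pi\left(\frac{mk}{j}\right)\right) + O(\sqrt{k}),$$ where the implied constant may depend on $n$ and $m$.
   Context: $\mathbb{N}=\{1,2,3,\dots\}$. For $x\in\mathbb{R}$, $\pi(x)$ is the number of primes $p\le x$ (so $\pi(x)=0$ for $x<2$ and the sum over $j$ is finite for each $k$). For $N\in\mathbb{N}$, $\omega(N)$ is the number of distinct primes dividing $N$, and $\omega\binom{a}{b}$ means $\omega\left(\binom{a}{b}\right)$. -}

module Defs where

open import Data.Nat using (ℕ; zero; suc; _*_; _∸_; _/_)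
open import Data.Nat.Divisibility using (_∣_; _∣?_)
open import Data.Nat.Primality using (Prime; prime?)
open import Data.Nat.Combinatorics using (_C_)
open import Data.List using (List; []; _∷_; length; filter; upTo; map; sum)
open import Data.Integer using (ℤ; +_; _-_)
open import Data.Integer as ℤ using ()
open import Relation.Nullary.Decidable using (_×-dec_)

primeCount : ℕ → ℕ
primeCount x = length (filter prime? (upTo (suc x)))

-- ω N = number of distinct primes dividing N (for N ≥ 1 all such primes are ≤ N)
omega : ℕ → ℕ
omega N = length (filter (λ p → prime? p ×-dec (p ∣? N)) (upTo (suc N)))

-- the j-th summand, j = suc i ≥ 1 :
--   π(nk/j) - π((n-m)k/j) - π(mk/j), using π(x/j) = π(⌊x/j⌋)
term : ℕ → ℕ → ℕ → ℕ → ℤ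
term n m k i =
  (+ primeCount ((n * k) / suc i) - + primeCount (((n ∸ m) * k) / suc i))
    - + primeCount ((m * k) / suc i)

-- Σ_{j ≥ 1} term; all summands with j > n k vanish (every floor is 0), so
-- the sum over j = 1 .. n k is the full infinite sum.
sumℤ : List ℤ → ℤ
sumℤ [] = + 0
sumℤ (x ∷ xs) = x ℤ.+ sumℤ xs

mainSum : ℕ → ℕ → ℕ → ℤ
mainSum n m k = sumℤ (map (term n m k) (upTo (n * k)))

{-# OPTIONS --safe #-}

-- Write N = M + L. For a prime p > √N, Legendre's formula reduces the exponent of p in C(N, M)
-- to ⌊N/p⌋ - ⌊M/p⌋ - ⌊L/p⌋, the carry out of the units digit when adding M and L in base p,
-- which is 0 or 1; so p divides C(N, M) exactly when this carry is 1.
-- Counting pairs (j, p) with p * j ≤ x gives Σ_{j ≥ 1} π(x/j) = Σ_p ⌊x/p⌋, so the main sum is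
-- Σ_p (⌊N/p⌋ - ⌊M/p⌋ - ⌊L/p⌋). Thus ω(C(N, M)) and the main sum agree at every prime above √N
-- and differ by at most 1 at each of the at most √N primes below it.
module Submission where

open import Defs
open import Data.Nat using (ℕ; _*_; _^_; _≤_; _≥_)
open import Data.Nat.Combinatorics using (_C_)
open import Data.Integer using (+_; _-_; ∣_∣)
open import Data.Product using (∃₂)

open import Data.Bool using (if_then_else_)
open import Data.Empty using (⊥-elim)
open import Data.List using ([]; _∷_; length; filter; upTo; applyUpTo; map)
open import Data.List.Properties using (map-upTo)
open import Data.Nat using (zero; suc; >-nonZero⁻¹; _+_; _∸_; _<_; _!; z≤n; s≤s; z<s; s<s; NonZero; _≤?_; _<?_)
import Data.Nat as ℕ
open import Data.Nat.Combinatorics using (nCk≡n!/k![n-k]!; k![n∸k]!∣n!)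
open import Data.Nat.DivMod
open import Data.Nat.Divisibility using (_∣_; _∤_; _∣?_; divides; >⇒∤; m∣m*n; ∣m⇒∣m*n; ∣1⇒≡1)
open import Data.Nat.ListAction using (sum)
open import Data.Nat.Primality using (Prime; prime?; euclidsLemma; ¬prime[1])
open import Data.Nat.Properties
open import Algebra.Properties.CommutativeSemigroup +-commutativeSemigroup
  using () renaming (interchange to +-interchange)
open import Algebra.Properties.CommutativeSemigroup *-commutativeSemigroup
  using () renaming (interchange to *-interchange; x∙yz≈y∙xz to x*[y*z]≡y*[x*z])
open import Data.Nat.Tactic.RingSolver using (solve-∀)
open import Data.Product using (Σ; _,_; _×_; proj₁; proj₂)
open import Data.Sum using (inj₁; inj₂)
open import Function using (_∘_; id)
open import Relation.Binary.PropositionalEquality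
open import Relation.Nullary using (Dec; yes; no; ¬_; does)
open import Relation.Nullary.Decidable using (_×-dec_)
open import Relation.Unary using (Decidable)
import Data.Integer as ℤ
import Data.Integer.Properties as ℤ
import Data.Integer.Tactic.RingSolver as ℤ

∑< : ℕ → (ℕ → ℕ) → ℕ
∑< n f = sum (applyUpTo f n)

syntax ∑< n (λ i → e) = ∑[ i < n ] e

∑-cong : ∀ n {f g : ℕ → ℕ} → (∀ i → i < n → f i ≡ g i) → ∑< n f ≡ ∑< n g
∑-cong zero    eq = refl
∑-cong (suc n) eq = cong₂ _+_ (eq 0 z<s) (∑-cong n (λ i i<n → eq (suc i) (s<s i<n)))

∑-zero : ∀ n {f : ℕ → ℕ} → (∀ i → i < n → f i ≡ 0) → ∑< n f ≡ 0
∑-zero zero    eq = refl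
∑-zero (suc n) eq = cong₂ _+_ (eq 0 z<s) (∑-zero n (λ i i<n → eq (suc i) (s<s i<n)))

∑-const-1 : ∀ n → ∑[ i < n ] 1 ≡ n
∑-const-1 zero    = refl
∑-const-1 (suc n) = cong suc (∑-const-1 n)

∑-snoc : ∀ n f → ∑< (suc n) f ≡ ∑< n f + f n
∑-snoc zero    f = +-identityʳ (f 0)
∑-snoc (suc n) f = trans (cong (_+_ (f 0)) (∑-snoc n (f ∘ suc))) (sym (+-assoc (f 0) _ _))

∑-split : ∀ m n f → ∑< (m + n) f ≡ ∑< m f + ∑[ i < n ] f (m + i)
∑-split zero    n f = refl
∑-split (suc m) n f = trans (cong (_+_ (f 0)) (∑-split m n (f ∘ suc))) (sym (+-assoc (f 0) _ _))

∑-distrib-+ : ∀ n f g → ∑[ i < n ] (f i + g i) ≡ ∑< n f + ∑< n g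
∑-distrib-+ zero    f g = refl
∑-distrib-+ (suc n) f g = trans (cong (_+_ (f 0 + g 0)) (∑-distrib-+ n (f ∘ suc) (g ∘ suc)))
  (+-interchange (f 0) (g 0) (∑< n (f ∘ suc)) (∑< n (g ∘ suc)))

*-distribʳ-∑ : ∀ n f c → ∑< n f * c ≡ ∑[ i < n ] (f i * c)
*-distribʳ-∑ zero    f c = refl
*-distribʳ-∑ (suc n) f c = trans (*-distribʳ-+ c (f 0) (∑< n (f ∘ suc))) (cong (_+_ (f 0 * c)) (*-distribʳ-∑ n (f ∘ suc) c))

∑-comm : ∀ m n (h : ℕ → ℕ → ℕ) → ∑[ i < m ] ∑< n (h i) ≡ ∑[ j < n ] ∑[ i < m ] h i j
∑-comm zero    n h = sym (∑-zero n (λ _ _ → refl))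
∑-comm (suc m) n h = trans (cong (_+_ (∑< n (h 0))) (∑-comm m n (h ∘ suc))) (sym (∑-distrib-+ n (h 0) _))

∑-mono-≤ : ∀ n {f g : ℕ → ℕ} → (∀ i → i < n → f i ≤ g i) → ∑< n f ≤ ∑< n g
∑-mono-≤ zero    le = z≤n
∑-mono-≤ (suc n) le = +-mono-≤ (le 0 z<s) (∑-mono-≤ n (λ i i<n → le (suc i) (s<s i<n)))

∑-extend : ∀ {m n} f → m ≤ n → (∀ i → m ≤ i → f i ≡ 0) → ∑< n f ≡ ∑< m f
∑-extend {m} {n} f m≤n vanish = begin
  ∑< n f                             ≡⟨ cong (λ k → ∑< k f) (m+[n∸m]≡n m≤n) ⟨
  ∑< (m + (n ∸ m)) f                 ≡⟨ ∑-split m (n ∸ m) f ⟩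
  ∑< m f + ∑[ i < n ∸ m ] f (m + i)  ≡⟨ cong (_+_ (∑< m f)) (∑-zero (n ∸ m) (λ i _ → vanish (m + i) (m≤m+n m i))) ⟩
  ∑< m f + 0                         ≡⟨ +-identityʳ _ ⟩
  ∑< m f                             ∎
  where open ≡-Reasoning

∑-vanishing-beyond : ∀ {m n} f → (∀ i → m ≤ i → f i ≡ 0) → (∀ i → n ≤ i → f i ≡ 0) → ∑< m f ≡ ∑< n f
∑-vanishing-beyond {m} {n} f vanishₘ vanishₙ with ≤-total m n
... | inj₁ m≤n = sym (∑-extend f m≤n vanishₘ)
... | inj₂ n≤m = ∑-extend f n≤m vanishₙ

∣m+n-o+p∣≤∣m-o∣+∣n-p∣ : ∀ m n o p → ℕ.∣ m + n - o + p ∣ ≤ ℕ.∣ m - o ∣ + ℕ.∣ n - p ∣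
∣m+n-o+p∣≤∣m-o∣+∣n-p∣ m n o p = begin
  ℕ.∣ m + n - o + p ∣                          ≤⟨ ∣-∣-triangle (m + n) (o + n) (o + p) ⟩
  ℕ.∣ m + n - o + n ∣ + ℕ.∣ o + n - o + p ∣    ≡⟨ cong₂ (λ a b → ℕ.∣ a - b ∣ + ℕ.∣ o + n - o + p ∣) (+-comm m n) (+-comm o n) ⟩
  ℕ.∣ n + m - n + o ∣ + ℕ.∣ o + n - o + p ∣    ≡⟨ cong₂ _+_ (∣m+n-m+o∣≡∣n-o∣ n m o) (∣m+n-m+o∣≡∣n-o∣ o n p) ⟩
  ℕ.∣ m - o ∣ + ℕ.∣ n - p ∣                    ∎
  where open ≤-Reasoning

∣∑-∑∣≤∑∣-∣ : ∀ n f g → ℕ.∣ ∑< n f - ∑< n g ∣ ≤ ∑[ i < n ] ℕ.∣ f i - g i ∣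
∣∑-∑∣≤∑∣-∣ zero    f g = z≤n
∣∑-∑∣≤∑∣-∣ (suc n) f g = ≤-trans (∣m+n-o+p∣≤∣m-o∣+∣n-p∣ (f 0) _ (g 0) _)
  (+-monoʳ-≤ ℕ.∣ f 0 - g 0 ∣ (∣∑-∑∣≤∑∣-∣ n (f ∘ suc) (g ∘ suc)))

𝟙 : ∀ {a} {A : Set a} → Dec A → ℕ
𝟙 d = if does d then 1 else 0

𝟙≤1 : ∀ {a} {A : Set a} (d : Dec A) → 𝟙 d ≤ 1
𝟙≤1 (yes _) = ≤-refl
𝟙≤1 (no _)  = z≤n

𝟙-true : ∀ {a} {A : Set a} (d : Dec A) → A → 𝟙 d ≡ 1
𝟙-true (yes _) _ = refl
𝟙-true (no ¬x) x = ⊥-elim (¬x x)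

𝟙-false : ∀ {a} {A : Set a} (d : Dec A) → ¬ A → 𝟙 d ≡ 0
𝟙-false (yes x) ¬x = ⊥-elim (¬x x)
𝟙-false (no _)  _  = refl

𝟙-*-≡0 : ∀ {a} {A : Set a} (d : Dec A) {x : ℕ} → (A → x ≡ 0) → 𝟙 d * x ≡ 0
𝟙-*-≡0 (yes a) {x} x≡0 = trans (+-identityʳ x) (x≡0 a)
𝟙-*-≡0 (no _)  _       = refl

𝟙-cong : ∀ {a b} {A : Set a} {B : Set b} (d : Dec A) (e : Dec B) → (A → B) → (B → A) → 𝟙 d ≡ 𝟙 e
𝟙-cong (yes x) e to _    = sym (𝟙-true e (to x))
𝟙-cong (no ¬x) e _  from = sym (𝟙-false e (¬x ∘ from))

𝟙-×-dec : ∀ {a b} {A : Set a} {B : Set b} (d : Dec A) (e : Dec B) → 𝟙 (d ×-dec e) ≡ 𝟙 d * 𝟙 e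
𝟙-×-dec (yes _) (yes _) = refl
𝟙-×-dec (yes _) (no _)  = refl
𝟙-×-dec (no _)  _       = refl

length-filter-applyUpTo : ∀ {p} {P : ℕ → Set p} (P? : Decidable P) f n →
  length (filter P? (applyUpTo f n)) ≡ ∑[ i < n ] 𝟙 (P? (f i))
length-filter-applyUpTo P? f zero = refl
length-filter-applyUpTo P? f (suc n) with P? (f 0)
... | yes _ = cong suc (length-filter-applyUpTo P? (f ∘ suc) n)
... | no _  = length-filter-applyUpTo P? (f ∘ suc) n

∑-restrict : ∀ {m n} g → m ≤ n → ∑[ i < n ] (𝟙 (i <? m) * g i) ≡ ∑< m g
∑-restrict {m} {n} g m≤n = begin
  ∑[ i < n ] (𝟙 (i <? m) * g i)  ≡⟨ ∑-extend _ m≤n (λ i m≤i → 𝟙-*-≡0 (i <? m) (λ i<m → ⊥-elim (<⇒≱ i<m m≤i))) ⟩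
  ∑[ i < m ] (𝟙 (i <? m) * g i)  ≡⟨ ∑-cong m (λ i i<m → trans (cong (_* g i) (𝟙-true (i <? m) i<m)) (+-identityʳ (g i))) ⟩
  ∑< m g                         ∎
  where open ≡-Reasoning

∑-𝟙-< : ∀ {m n} → m ≤ n → ∑[ i < n ] 𝟙 (i <? m) ≡ m
∑-𝟙-< {m} {n} m≤n = begin
  ∑[ i < n ] 𝟙 (i <? m)        ≡⟨ ∑-cong n (λ i _ → *-identityʳ (𝟙 (i <? m))) ⟨
  ∑[ i < n ] (𝟙 (i <? m) * 1)  ≡⟨ ∑-restrict (λ _ → 1) m≤n ⟩
  ∑[ i < m ] 1                 ≡⟨ ∑-const-1 m ⟩
  m                            ∎
  where open ≡-Reasoning

⌊√_⌋ : ℕ → ℕ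
⌊√ n ⌋ = ∑[ r < n ] 𝟙 (suc r * suc r ≤? n)

∑-squares-bound : ∀ n k → let s = ∑[ r < k ] 𝟙 (suc r * suc r ≤? n) in s ≤ k × s * s ≤ n
∑-squares-bound n zero    = z≤n , z≤n
∑-squares-bound n (suc k) rewrite ∑-snoc k (λ r → 𝟙 (suc r * suc r ≤? n)) =
  step (suc k * suc k ≤? n) (proj₁ (∑-squares-bound n k)) (proj₂ (∑-squares-bound n k))
  where
  step : ∀ {s} (d : Dec (suc k * suc k ≤ n)) → s ≤ k → s * s ≤ n →
         s + 𝟙 d ≤ suc k × (s + 𝟙 d) * (s + 𝟙 d) ≤ n
  step {s} (yes k²≤n) s≤k _   rewrite +-comm s 1 = s≤s s≤k , ≤-trans (*-mono-≤ (s≤s s≤k) (s≤s s≤k)) k²≤n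
  step {s} (no _)     s≤k s²≤n rewrite +-identityʳ s = m≤n⇒m≤1+n s≤k , s²≤n

⌊√n⌋²≤n : ∀ n → ⌊√ n ⌋ * ⌊√ n ⌋ ≤ n
⌊√n⌋²≤n n = proj₂ (∑-squares-bound n n)

𝟙prime : ℕ → ℕ
𝟙prime r = 𝟙 (prime? (suc r))

primeCount-∑ : ∀ x → primeCount x ≡ ∑[ r < x ] 𝟙prime r
primeCount-∑ x = length-filter-applyUpTo prime? id (suc x)

omega-∑ : ∀ c → omega c ≡ ∑[ r < c ] (𝟙prime r * 𝟙 (suc r ∣? c))
omega-∑ c = trans (length-filter-applyUpTo (λ p → prime? p ×-dec (p ∣? c)) id (suc c))
  (∑-cong c (λ r _ → 𝟙-×-dec (prime? (suc r)) (suc r ∣? c)))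

m*n≤o⇒m≤o/n : ∀ m {n o} .{{_ : NonZero n}} → m * n ≤ o → m ≤ o / n
m*n≤o⇒m≤o/n m {n} le = ≤-trans (≤-reflexive (sym (m*n/n≡m m n))) (/-monoˡ-≤ n le)

m≤o/n⇒m*n≤o : ∀ {m} n {o} .{{_ : NonZero n}} → m ≤ o / n → m * n ≤ o
m≤o/n⇒m*n≤o n {o} le = ≤-trans (*-monoˡ-≤ n le) (m/n*n≤m o n)

m<[1+m/n]*n : ∀ m n .{{_ : NonZero n}} → m < suc (m / n) * n
m<[1+m/n]*n m n = begin-strict
  m                   ≡⟨ m≡m%n+[m/n]*n m n ⟩
  m % n + m / n * n   <⟨ +-monoˡ-< (m / n * n) (m%n<n m n) ⟩
  suc (m / n) * n     ∎
  where open ≤-Reasoning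

/-unique : ∀ {m q} d .{{_ : NonZero d}} → q * d ≤ m → m < suc q * d → m / d ≡ q
/-unique {q = q} d lo hi = ≤-antisym (≤-pred (m<n*o⇒m/o<n hi)) (m*n≤o⇒m≤o/n q lo)

<-/-swap : ∀ x i r → r < x / suc i → i < x / suc r
<-/-swap x i r lt = m*n≤o⇒m≤o/n (suc i) (subst (_≤ x) (*-comm (suc r) (suc i)) (m≤o/n⇒m*n≤o (suc i) lt))

∑-primeCount-/ : ∀ x {n} → x ≤ n → ∑[ i < n ] primeCount (x / suc i) ≡ ∑[ r < n ] (𝟙prime r * (x / suc r))
∑-primeCount-/ x {n} x≤n = begin
  ∑[ i < n ] primeCount (x / suc i)                    ≡⟨ ∑-cong n (λ i _ → trans (primeCount-∑ (x / suc i)) (sym (∑-restrict 𝟙prime (bounded i)))) ⟩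
  ∑[ i < n ] ∑[ r < n ] (𝟙 (r <? x / suc i) * 𝟙prime r) ≡⟨ ∑-comm n n _ ⟩
  ∑[ r < n ] ∑[ i < n ] (𝟙 (r <? x / suc i) * 𝟙prime r) ≡⟨ ∑-cong n (λ r _ → multiplicity r) ⟩
  ∑[ r < n ] (𝟙prime r * (x / suc r))                  ∎
  where
  open ≡-Reasoning
  bounded : ∀ i → x / suc i ≤ n
  bounded i = ≤-trans (m/n≤m x (suc i)) x≤n
  multiplicity : ∀ r → ∑[ i < n ] (𝟙 (r <? x / suc i) * 𝟙prime r) ≡ 𝟙prime r * (x / suc r)
  multiplicity r = begin
    ∑[ i < n ] (𝟙 (r <? x / suc i) * 𝟙prime r)   ≡⟨ *-distribʳ-∑ n _ (𝟙prime r) ⟨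
    (∑[ i < n ] 𝟙 (r <? x / suc i)) * 𝟙prime r   ≡⟨ cong (_* 𝟙prime r) (∑-cong n (λ i _ → swap i)) ⟩
    (∑[ i < n ] 𝟙 (i <? x / suc r)) * 𝟙prime r   ≡⟨ cong (_* 𝟙prime r) (∑-𝟙-< (bounded r)) ⟩
    x / suc r * 𝟙prime r                         ≡⟨ *-comm (x / suc r) (𝟙prime r) ⟩
    𝟙prime r * (x / suc r)                       ∎
    where
    swap : ∀ i → 𝟙 (r <? x / suc i) ≡ 𝟙 (i <? x / suc r)
    swap i = 𝟙-cong (r <? x / suc i) (i <? x / suc r) (<-/-swap x i r) (<-/-swap x r i)

carry : ∀ m n d .{{_ : NonZero d}} → ℕ
carry m n d = (m + n) / d ∸ (m / d + n / d)

/-+-≤ : ∀ m n d .{{_ : NonZero d}} → m / d + n / d ≤ (m + n) / d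
/-+-≤ m n d = m*n≤o⇒m≤o/n (m / d + n / d)
  (subst (_≤ m + n) (sym (*-distribʳ-+ d (m / d) (n / d))) (+-mono-≤ (m/n*n≤m m d) (m/n*n≤m n d)))

+-/-≤ : ∀ m n d .{{_ : NonZero d}} → (m + n) / d ≤ suc (m / d + n / d)
+-/-≤ m n d = ≤-pred (m<n*o⇒m/o<n (begin-strict
  m + n                                <⟨ +-mono-< (m<[1+m/n]*n m d) (m<[1+m/n]*n n d) ⟩
  suc (m / d) * d + suc (n / d) * d    ≡⟨ *-distribʳ-+ d (suc (m / d)) (suc (n / d)) ⟨
  (suc (m / d) + suc (n / d)) * d      ≡⟨ cong (λ k → suc k * d) (+-suc (m / d) (n / d)) ⟩
  suc (suc (m / d + n / d)) * d        ∎))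
  where open ≤-Reasoning

+-/-carry : ∀ m n d .{{_ : NonZero d}} → (m + n) / d ≡ m / d + n / d + carry m n d
+-/-carry m n d = sym (m+[n∸m]≡n (/-+-≤ m n d))

carry≤1 : ∀ m n d .{{_ : NonZero d}} → carry m n d ≤ 1
carry≤1 m n d = m≤n+o⇒m∸n≤o _ (m / d + n / d) (subst ((m + n) / d ≤_) (+-comm 1 _) (+-/-≤ m n d))

prime∤1 : ∀ {p} → Prime p → p ∤ 1
prime∤1 pp p∣1 = ¬prime[1] (subst Prime (∣1⇒≡1 p∣1) pp)

prime∤* : ∀ {p m n} → Prime p → p ∤ m → p ∤ n → p ∤ m * n
prime∤* {m = m} {n} pp p∤m p∤n p∣mn with euclidsLemma m n pp p∣mn
... | inj₁ p∣m = p∤m p∣m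
... | inj₂ p∣n = p∤n p∣n

-- Below p² the only multiples of p are q * p with q < p, each contributing exactly one factor p.
factorial-split : ∀ {p} .{{_ : NonZero p}} → Prime p → ∀ n → n < p * p →
                  Σ ℕ λ R → n ! ≡ p ^ (n / p) * R × p ∤ R
factorial-split {p} pp zero _ = 1 , sym (cong (λ k → p ^ k * 1) (0/n≡0 p)) , prime∤1 pp
factorial-split {p} pp (suc n) bound with factorial-split pp n (<-trans (n<1+n n) bound) | p ∣? suc n
... | R , n!≡ , p∤R | no p∤1+n = suc n * R , eq , prime∤* pp p∤1+n p∤R
  where
  same-quotient : suc n / p ≡ n / p
  same-quotient = /-unique p (≤-trans (m/n*n≤m n p) (n≤1+n n))
                    (≤∧≢⇒< (m<[1+m/n]*n n p) (λ 1+n≡ → p∤1+n (divides (suc (n / p)) 1+n≡)))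
  eq : suc n ! ≡ p ^ (suc n / p) * (suc n * R)
  eq = begin
    suc n * n !                ≡⟨ cong (suc n *_) n!≡ ⟩
    suc n * (p ^ (n / p) * R)  ≡⟨ x*[y*z]≡y*[x*z] (suc n) (p ^ (n / p)) R ⟩
    p ^ (n / p) * (suc n * R)  ≡⟨ cong (λ k → p ^ k * (suc n * R)) same-quotient ⟨
    p ^ (suc n / p) * (suc n * R) ∎
    where open ≡-Reasoning
... | R , n!≡ , p∤R | yes (divides zero ())
... | R , n!≡ , p∤R | yes (divides (suc q) 1+n≡) = suc q * R , eq , prime∤* pp (>⇒∤ q<p) p∤R
  where
  n-quotient : n / p ≡ q
  n-quotient = /-unique p (≤-pred (subst (q * p <_) (sym 1+n≡) (m<n+m (q * p) (>-nonZero⁻¹ p))))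
                 (subst (n <_) 1+n≡ (n<1+n n))
  q<p : suc q < p
  q<p = *-cancelʳ-< p (suc q) p (subst (_< p * p) 1+n≡ bound)
  eq : suc n ! ≡ p ^ (suc n / p) * (suc q * R)
  eq = begin
    suc n * n !                    ≡⟨ cong₂ _*_ 1+n≡ (trans n!≡ (cong (λ k → p ^ k * R) n-quotient)) ⟩
    suc q * p * (p ^ q * R)        ≡⟨ cong (_* (p ^ q * R)) (*-comm (suc q) p) ⟩
    p * suc q * (p ^ q * R)        ≡⟨ *-interchange p (suc q) (p ^ q) R ⟩
    p ^ suc q * (suc q * R)        ≡⟨ cong (λ k → p ^ k * (suc q * R)) (trans (cong (_/ p) 1+n≡) (m*n/n≡m (suc q) p)) ⟨
    p ^ (suc n / p) * (suc q * R)  ∎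
    where open ≡-Reasoning

𝟙[p∣a]≡e : ∀ {p a u v e} → Prime p → p ∤ u → p ∤ v → e ≤ 1 → a * u ≡ p ^ e * v → 𝟙 (p ∣? a) ≡ e
𝟙[p∣a]≡e {p} {a} {u} {v} {zero} _ _ p∤v _ au≡v =
  𝟙-false (p ∣? a) (λ p∣a → p∤v (subst (p ∣_) (trans au≡v (+-identityʳ v)) (∣m⇒∣m*n u p∣a)))
𝟙[p∣a]≡e {p} {a} {u} {v} {suc zero} pp p∤u _ _ au≡pv with euclidsLemma a u pp (subst (p ∣_) (sym au≡pv) (∣m⇒∣m*n v (m∣m*n 1)))
... | inj₁ p∣a = 𝟙-true (p ∣? a) p∣a
... | inj₂ p∣u = ⊥-elim (p∤u p∣u)
𝟙[p∣a]≡e {e = suc (suc _)} _ _ _ (s≤s ()) _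

𝟙[p∣binomial]≡carry : ∀ {p} .{{_ : NonZero p}} → Prime p → ∀ m n c → m + n < p * p →
                      c * (m ! * n !) ≡ (m + n) ! → 𝟙 (p ∣? c) ≡ carry m n p
𝟙[p∣binomial]≡carry {p} pp m n c bound c*m!*n!≡
  with factorial-split pp m (≤-<-trans (m≤m+n m n) bound)
     | factorial-split pp n (≤-<-trans (m≤n+m n m) bound)
     | factorial-split pp (m + n) bound
... | Rₘ , m!≡ , p∤Rₘ | Rₙ , n!≡ , p∤Rₙ | R , [m+n]!≡ , p∤R =
  𝟙[p∣a]≡e pp (prime∤* pp p∤Rₘ p∤Rₙ) p∤R (carry≤1 m n p) (*-cancelˡ-≡ _ _ (p ^ (m / p + n / p)) {{m^n≢0 p (m / p + n / p)}} eq)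
  where
  open ≡-Reasoning
  rearrange : ∀ x y c u w → x * y * (c * (u * w)) ≡ c * (x * u * (y * w))
  rearrange = solve-∀
  eq : p ^ (m / p + n / p) * (c * (Rₘ * Rₙ)) ≡ p ^ (m / p + n / p) * (p ^ carry m n p * R)
  eq = begin
    p ^ (m / p + n / p) * (c * (Rₘ * Rₙ))         ≡⟨ cong (_* (c * (Rₘ * Rₙ))) (^-distribˡ-+-* p (m / p) (n / p)) ⟩
    p ^ (m / p) * p ^ (n / p) * (c * (Rₘ * Rₙ))   ≡⟨ rearrange (p ^ (m / p)) (p ^ (n / p)) c Rₘ Rₙ ⟩
    c * (p ^ (m / p) * Rₘ * (p ^ (n / p) * Rₙ))   ≡⟨ cong (c *_) (cong₂ _*_ m!≡ n!≡) ⟨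
    c * (m ! * n !)                               ≡⟨ c*m!*n!≡ ⟩
    (m + n) !                                     ≡⟨ [m+n]!≡ ⟩
    p ^ ((m + n) / p) * R                         ≡⟨ cong (λ k → p ^ k * R) (+-/-carry m n p) ⟩
    p ^ (m / p + n / p + carry m n p) * R         ≡⟨ cong (_* R) (^-distribˡ-+-* p (m / p + n / p) (carry m n p)) ⟩
    p ^ (m / p + n / p) * p ^ carry m n p * R     ≡⟨ *-assoc (p ^ (m / p + n / p)) (p ^ carry m n p) R ⟩
    p ^ (m / p + n / p) * (p ^ carry m n p * R)   ∎

carry-beyond : ∀ m n d .{{_ : NonZero d}} → m + n < d → carry m n d ≡ 0
carry-beyond m n d m+n<d = trans (cong (_∸ (m / d + n / d)) (m<n⇒m/n≡0 m+n<d)) (0∸n≡0 (m / d + n / d))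

C-factorials : ∀ m n → ((m + n) C m) * (m ! * n !) ≡ (m + n) !
C-factorials m n = begin
  ((m + n) C m) * (m ! * n !)                                ≡⟨ cong (λ k → ((m + n) C m) * (m ! * k !)) (m+n∸m≡n m n) ⟨
  ((m + n) C m) * (m ! * (m + n ∸ m) !)                      ≡⟨ cong (_* (m ! * (m + n ∸ m) !)) (nCk≡n!/k![n-k]! (m≤m+n m n)) ⟩
  (m + n) ! / (m ! * (m + n ∸ m) !) * (m ! * (m + n ∸ m) !) ≡⟨ m/n*n≡m (k![n∸k]!∣n! (m≤m+n m n)) ⟩
  (m + n) !                                                ∎
  where
  open ≡-Reasoning
  instance
    m!*[m+n∸m]!≢0 : NonZero (m ! * (m + n ∸ m) !)
    m!*[m+n∸m]!≢0 = m !* (m + n ∸ m) !≢0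

C-nonZero : ∀ m n → NonZero ((m + n) C m)
C-nonZero m n with (m + n) C m in C≡
... | zero  = ⊥-elim (<⇒≱ (1≤n! (m + n)) (≤-reflexive (trans (sym (C-factorials m n)) (cong (_* (m ! * n !)) C≡))))
... | suc _ = _

module _ (m n : ℕ) where

  private
    N : ℕ
    N = m + n
    B : ℕ
    B = N C m
    instance
      B≢0 : NonZero B
      B≢0 = C-nonZero m n

  omega-binomial-∑ : omega B ≡ ∑[ r < N ] (𝟙prime r * 𝟙 (suc r ∣? B))
  omega-binomial-∑ = trans (omega-∑ B) (∑-vanishing-beyond _ beyond-B beyond-N)
    where
    beyond-B : ∀ r → B ≤ r → 𝟙prime r * 𝟙 (suc r ∣? B) ≡ 0
    beyond-B r B≤r = trans (cong (𝟙prime r *_) (𝟙-false (suc r ∣? B) (>⇒∤ (s≤s B≤r)))) (*-zeroʳ (𝟙prime r))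
    beyond-N : ∀ r → N ≤ r → 𝟙prime r * 𝟙 (suc r ∣? B) ≡ 0
    beyond-N r N≤r = 𝟙-*-≡0 (prime? (suc r)) (λ pp →
      trans (𝟙[p∣binomial]≡carry pp m n B (≤-trans (s≤s N≤r) (m≤m*n (suc r) (suc r))) (C-factorials m n))
            (carry-beyond m n (suc r) (s≤s N≤r)))

  omega-binomial-≈ : ℕ.∣ omega B - ∑[ r < N ] (𝟙prime r * carry m n (suc r)) ∣ ≤ ⌊√ N ⌋
  omega-binomial-≈ = begin
    ℕ.∣ omega B - ∑[ r < N ] (𝟙prime r * carry m n (suc r)) ∣
      ≡⟨ cong (λ x → ℕ.∣ x - ∑[ r < N ] (𝟙prime r * carry m n (suc r)) ∣) omega-binomial-∑ ⟩
    ℕ.∣ ∑[ r < N ] (𝟙prime r * 𝟙 (suc r ∣? B)) - ∑[ r < N ] (𝟙prime r * carry m n (suc r)) ∣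
      ≤⟨ ∣∑-∑∣≤∑∣-∣ N _ _ ⟩
    ∑[ r < N ] ℕ.∣ 𝟙prime r * 𝟙 (suc r ∣? B) - 𝟙prime r * carry m n (suc r) ∣
      ≤⟨ ∑-mono-≤ N (λ r _ → termwise r) ⟩
    ⌊√ N ⌋ ∎
    where
    open ≤-Reasoning
    termwise : ∀ r → ℕ.∣ 𝟙prime r * 𝟙 (suc r ∣? B) - 𝟙prime r * carry m n (suc r) ∣ ≤ 𝟙 (suc r * suc r ≤? N)
    termwise r = subst (_≤ 𝟙 (suc r * suc r ≤? N)) (*-distribˡ-∣-∣ (𝟙prime r) _ _)
                   (bound (prime? (suc r)) (suc r * suc r ≤? N))
      where
      bound : (dₚ : Dec (Prime (suc r))) (dₛ : Dec (suc r * suc r ≤ N)) →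
              𝟙 dₚ * ℕ.∣ 𝟙 (suc r ∣? B) - carry m n (suc r) ∣ ≤ 𝟙 dₛ
      bound (no _)   _         = z≤n
      bound (yes _)  (yes _)   = ≤-trans (≤-reflexive (+-identityʳ _))
        (≤-trans (∣m-n∣≤m⊔n (𝟙 (suc r ∣? B)) (carry m n (suc r))) (⊔-lub (𝟙≤1 (suc r ∣? B)) (carry≤1 m n (suc r))))
      bound (yes pp) (no big) = ≤-reflexive (trans (+-identityʳ _)
        (m≡n⇒∣m-n∣≡0 (𝟙[p∣binomial]≡carry pp m n B (≰⇒> big) (C-factorials m n))))

sumℤ-map-- : ∀ {A : Set} (f g : A → ℤ.ℤ) xs → sumℤ (map (λ x → f x - g x) xs) ≡ sumℤ (map f xs) - sumℤ (map g xs)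
sumℤ-map-- f g []       = refl
sumℤ-map-- f g (x ∷ xs) = trans (cong (ℤ._+_ (f x - g x)) (sumℤ-map-- f g xs))
  ([a-b]+[c-d]≡[a+c]-[b+d] (f x) (g x) (sumℤ (map f xs)) (sumℤ (map g xs)))
  where
  [a-b]+[c-d]≡[a+c]-[b+d] : ∀ a b c d → (a - b) ℤ.+ (c - d) ≡ (a ℤ.+ c) - (b ℤ.+ d)
  [a-b]+[c-d]≡[a+c]-[b+d] = ℤ.solve-∀

sumℤ-map-+ : ∀ {A : Set} (f : A → ℕ) xs → sumℤ (map (λ x → + f x) xs) ≡ + sum (map f xs)
sumℤ-map-+ f []       = refl
sumℤ-map-+ f (x ∷ xs) = trans (cong (ℤ._+_ (+ f x)) (sumℤ-map-+ f xs)) (sym (ℤ.pos-+ (f x) (sum (map f xs))))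

sumℤ-upTo-[f-g]-h : ∀ f g h n → sumℤ (map (λ i → (+ f i - + g i) - + h i) (upTo n)) ≡ (+ ∑< n f - + ∑< n g) - + ∑< n h
sumℤ-upTo-[f-g]-h f g h n = begin
  sumℤ (map (λ i → (+ f i - + g i) - + h i) (upTo n))
    ≡⟨ sumℤ-map-- (λ i → + f i - + g i) (λ i → + h i) (upTo n) ⟩
  sumℤ (map (λ i → + f i - + g i) (upTo n)) - sumℤ (map (λ i → + h i) (upTo n))
    ≡⟨ cong (_- sumℤ (map (λ i → + h i) (upTo n))) (sumℤ-map-- (λ i → + f i) (λ i → + g i) (upTo n)) ⟩
  (sumℤ (map (λ i → + f i) (upTo n)) - sumℤ (map (λ i → + g i) (upTo n))) - sumℤ (map (λ i → + h i) (upTo n))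
    ≡⟨ cong₂ _-_ (cong₂ _-_ (pos-∑ f) (pos-∑ g)) (pos-∑ h) ⟩
  (+ ∑< n f - + ∑< n g) - + ∑< n h ∎
  where
  open ≡-Reasoning
  pos-∑ : ∀ f → sumℤ (map (λ i → + f i) (upTo n)) ≡ + ∑< n f
  pos-∑ f = trans (sumℤ-map-+ f (upTo n)) (cong (λ xs → + sum xs) (map-upTo f n))

[+[a+b+c]-+b]-+a≡+c : ∀ a b c → (+ (a + b + c) - + b) - + a ≡ + c
[+[a+b+c]-+b]-+a≡+c a b c = begin
  (+ (a + b + c) - + b) - + a                ≡⟨ cong (λ z → (z - + b) - + a) (trans (ℤ.pos-+ (a + b) c) (cong (ℤ._+ + c) (ℤ.pos-+ a b))) ⟩
  ((+ a ℤ.+ + b) ℤ.+ + c - + b) - + a        ≡⟨ cancel (+ a) (+ b) (+ c) ⟩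
  + c                                        ∎
  where
  open ≡-Reasoning
  cancel : ∀ x y z → ((x ℤ.+ y) ℤ.+ z - y) - x ≡ z
  cancel = ℤ.solve-∀

∣+m-+n∣≡∣m-n∣ : ∀ m n → ∣ + m - + n ∣ ≡ ℕ.∣ m - n ∣
∣+m-+n∣≡∣m-n∣ m n with ≤-total m n
... | inj₁ m≤n = trans (cong ∣_∣ (ℤ.[+m]-[+n]≡m⊖n m n)) (trans (ℤ.∣⊖∣-≤ m≤n) (sym (m≤n⇒∣m-n∣≡n∸m m≤n)))
... | inj₂ n≤m = trans (cong ∣_∣ (ℤ.[+m]-[+n]≡m⊖n m n))
  (trans (ℤ.∣m⊖n∣≡∣n⊖m∣ m n) (trans (ℤ.∣⊖∣-≤ n≤m) (sym (m≤n⇒∣n-m∣≡n∸m n≤m))))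

primeSum≡∑carry : ∀ m n →
  sumℤ (map (λ i → (+ primeCount ((m + n) / suc i) - + primeCount (n / suc i)) - + primeCount (m / suc i)) (upTo (m + n)))
  ≡ + ∑[ r < m + n ] (𝟙prime r * carry m n (suc r))
primeSum≡∑carry m n = begin
  sumℤ (map (λ i → (+ primeCount (N / suc i) - + primeCount (n / suc i)) - + primeCount (m / suc i)) (upTo N))
    ≡⟨ sumℤ-upTo-[f-g]-h (λ i → primeCount (N / suc i)) (λ i → primeCount (n / suc i)) (λ i → primeCount (m / suc i)) N ⟩
  (+ ∑[ i < N ] primeCount (N / suc i) - + Πₙ) - + Πₘ
    ≡⟨ cong (λ z → (+ z - + Πₙ) - + Πₘ) decompose ⟩
  (+ (Πₘ + Πₙ + Y) - + Πₙ) - + Πₘ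
    ≡⟨ [+[a+b+c]-+b]-+a≡+c Πₘ Πₙ Y ⟩
  + Y ∎
  where
  open ≡-Reasoning
  N Πₘ Πₙ Y : ℕ
  N = m + n
  Πₘ = ∑[ i < N ] primeCount (m / suc i)
  Πₙ = ∑[ i < N ] primeCount (n / suc i)
  Y = ∑[ r < N ] (𝟙prime r * carry m n (suc r))
  expand : ∀ r → 𝟙prime r * (N / suc r) ≡ 𝟙prime r * (m / suc r) + 𝟙prime r * (n / suc r) + 𝟙prime r * carry m n (suc r)
  expand r = trans (cong (𝟙prime r *_) (+-/-carry m n (suc r)))
    (trans (*-distribˡ-+ (𝟙prime r) (m / suc r + n / suc r) _) (cong (_+ 𝟙prime r * carry m n (suc r)) (*-distribˡ-+ (𝟙prime r) _ _)))
  decompose : ∑[ i < N ] primeCount (N / suc i) ≡ Πₘ + Πₙ + Y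
  decompose = begin
    ∑[ i < N ] primeCount (N / suc i)   ≡⟨ ∑-primeCount-/ N ≤-refl ⟩
    ∑[ r < N ] (𝟙prime r * (N / suc r)) ≡⟨ ∑-cong N (λ r _ → expand r) ⟩
    ∑[ r < N ] (𝟙prime r * (m / suc r) + 𝟙prime r * (n / suc r) + 𝟙prime r * carry m n (suc r))
      ≡⟨ ∑-distrib-+ N _ _ ⟩
    ∑[ r < N ] (𝟙prime r * (m / suc r) + 𝟙prime r * (n / suc r)) + Y
      ≡⟨ cong (_+ Y) (∑-distrib-+ N _ _) ⟩
    ∑[ r < N ] (𝟙prime r * (m / suc r)) + ∑[ r < N ] (𝟙prime r * (n / suc r)) + Y
      ≡⟨ cong₂ (λ a b → a + b + Y) (∑-primeCount-/ m (m≤m+n m n)) (∑-primeCount-/ n (m≤n+m n m)) ⟨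
    Πₘ + Πₙ + Y ∎

binomial-estimate : ∀ {N} m n → m + n ≡ N →
  ∣ + omega (N C m) - sumℤ (map (λ i → (+ primeCount (N / suc i) - + primeCount (n / suc i)) - + primeCount (m / suc i)) (upTo N)) ∣ ^ 2 ≤ N
binomial-estimate m n refl = begin
  ∣ + omega ((m + n) C m) - S ∣ ^ 2         ≡⟨ cong (λ z → ∣ + omega ((m + n) C m) - z ∣ ^ 2) (primeSum≡∑carry m n) ⟩
  ∣ + omega ((m + n) C m) - + Y ∣ ^ 2       ≡⟨ cong (_^ 2) (∣+m-+n∣≡∣m-n∣ (omega ((m + n) C m)) Y) ⟩
  ℕ.∣ omega ((m + n) C m) - Y ∣ ^ 2         ≤⟨ ^-monoˡ-≤ 2 (omega-binomial-≈ m n) ⟩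
  ⌊√ m + n ⌋ ^ 2                            ≡⟨ cong (⌊√ m + n ⌋ *_) (*-identityʳ ⌊√ m + n ⌋) ⟩
  ⌊√ m + n ⌋ * ⌊√ m + n ⌋                    ≤⟨ ⌊√n⌋²≤n (m + n) ⟩
  m + n                                     ∎
  where
  open ≤-Reasoning
  S : ℤ.ℤ
  S = sumℤ (map (λ i → (+ primeCount ((m + n) / suc i) - + primeCount (n / suc i)) - + primeCount (m / suc i)) (upTo (m + n)))
  Y : ℕ
  Y = ∑[ r < m + n ] (𝟙prime r * carry m n (suc r))

theorem1 : (n m : ℕ) → 1 ≤ m → m ≤ n →
    ∃₂ λ (c K : ℕ) → (k : ℕ) → k ≥ K →
      ∣ + omega ((n * k) C (m * k)) - mainSum n m k ∣ ^ 2 ≤ c * k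
theorem1 n m _ m≤n = n , 0 , λ k _ → binomial-estimate (m * k) ((n ∸ m) * k) (mk+[n∸m]k≡nk k)
  where
  mk+[n∸m]k≡nk : ∀ k → m * k + (n ∸ m) * k ≡ n * k
  mk+[n∸m]k≡nk k = trans (sym (*-distribʳ-+ k m (n ∸ m))) (cong (_* k) (m+[n∸m]≡n m≤n))
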